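{- Let $r\ge 3$ and let $H$ be a linear $r$-uniform hypergraph on $n$ vertices containing no linear path $P_3^r$ with three edges. Let $s$ be the number of vertices of $H$ of degree at least $r+1$. If $s>0$, then $|E(H)|<n-s$ (i.e., the bound $|E(H)|\le n-s$ is not attained).
   Context: An $r$-uniform hypergraph is linear if every pair of vertices lies in at most one edge. Degree of a vertex = number of edges containing it. $P_3^r$ is the linear $r$-uniform path with three edges $f_1,f_2,f_3$ where $|f_1\cap f_2|=|f_2\cap f_3|=1$ and $f_1\cap f_3=\varnothing$. -}

module Defs where

open import Data.Nat using (ℕ; suc; _≤_; _≤?_)
open import Data.Fin using (Fin)
open import Data.Fin.Subset using (Subset; ∣_∣; _∩_)
open import Data.Vec using (tabulate; lookup)
open import Data.Product using (∃; _×_; _,_)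
open import Relation.Nullary using (¬_; does)
open import Relation.Binary.PropositionalEquality using (_≡_; _≢_)

-- A hypergraph on vertex set Fin n: a finite family of edges indexed by Fin m,
-- each edge a subset of the vertex set. |E(H)| = m (edges are required distinct below).
record Hypergraph (n : ℕ) : Set where
  field
    m    : ℕ
    edge : Fin m → Subset n
open Hypergraph public

DistinctEdges : ∀ {n} → Hypergraph n → Set
DistinctEdges H = ∀ e f → edge H e ≡ edge H f → e ≡ f

Uniform : ∀ {n} → ℕ → Hypergraph n → Set
Uniform r H = ∀ e → ∣ edge H e ∣ ≡ r

Linear : ∀ {n} → Hypergraph n → Set
Linear H = ∀ e f → e ≢ f → ∣ edge H e ∩ edge H f ∣ ≤ 1

degree : ∀ {n} → Hypergraph n → Fin n → ℕ
degree H v = ∣ tabulate (λ e → lookup (edge H e) v) ∣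

highDegCount : ∀ {n} → ℕ → Hypergraph n → ℕ
highDegCount r H = ∣ tabulate (λ v → does (suc r ≤? degree H v)) ∣

ContainsP3 : ∀ {n} → Hypergraph n → Set
ContainsP3 H = ∃ λ f₁ → ∃ λ f₂ → ∃ λ f₃ →
  (∣ edge H f₁ ∩ edge H f₂ ∣ ≡ 1) × (∣ edge H f₂ ∩ edge H f₃ ∣ ≡ 1) × (∣ edge H f₁ ∩ edge H f₃ ∣ ≡ 0)

{-# OPTIONS --safe #-}
module Submission where

-- Give a vertex of degree d the weight 0 if d > r, 2 if d ≤ 1 and 1 otherwise.
-- If c has degree > r, then every other vertex u of an edge e ∋ c has degree 1:
-- a second edge g ∋ u misses c by linearity, meets every edge at c (at u, or
-- else g, e, f is a P₃), and by linearity at distinct vertices, so |g| ≥ deg c > r.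
-- Hence every edge has total weight ≥ r, and ≥ 2(r − 1) > r if it contains a
-- vertex of degree > r, while d · weight(d) ≤ r for every vertex, with slack r
-- when d > r. Double counting incidences gives r·m < Σ_v d(v)·weight(d(v)) ≤ r(n − s).

open import Defs
open import Data.Bool using (Bool; true; false; T; _∧_; if_then_else_; T?)
open import Data.Bool.Properties using (T-∧)
open import Data.Fin using (Fin; zero; suc; _≟_)
open import Data.Fin.Properties using (any?; suc-injective)
open import Data.Fin.Subset using (Subset; ∣_∣; _∩_)
open import Data.Nat using (ℕ; zero; suc; _+_; _*_; _∸_; _≤_; _<_; _<ᵇ_; z≤n; s≤s)
open import Data.Nat.Properties hiding (_≟_; suc-injective)
open import Algebra.Properties.CommutativeSemigroup *-commutativeSemigroup
  using (x∙yz≈y∙xz)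
open import Algebra.Properties.Semiring.Sum +-*-semiring
  using (sum; sum-syntax; ∑-comm; ∑-distrib-+; *-distribˡ-sum; *-distribʳ-sum;
         sum-cong-≗; sum-replicate-zero)
open import Data.Product using (∃; _,_)
open import Data.Vec using ([]; _∷_; lookup; tabulate)
open import Data.Vec.Functional using (replicate)
open import Data.Vec.Properties using (lookup∘tabulate; lookup-zipWith)
open import Function using (_∘_; Equivalence)
open import Relation.Nullary using (¬_; Dec; yes; no; contradiction)
open import Relation.Nullary.Decidable using (_×-dec_)
open import Relation.Nullary.Reflects using (ofʸ; ofⁿ)
open import Relation.Binary.PropositionalEquality

open Equivalence using (to)

𝟙 : Bool → ℕ
𝟙 true  = 1
𝟙 false = 0

𝟙≤1 : ∀ b → 𝟙 b ≤ 1
𝟙≤1 true  = ≤-refl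
𝟙≤1 false = z≤n

T⇒𝟙≡1 : ∀ {b} → T b → 𝟙 b ≡ 1
T⇒𝟙≡1 {true} _ = refl

¬T⇒𝟙≡0 : ∀ {b} → ¬ T b → 𝟙 b ≡ 0
¬T⇒𝟙≡0 {true}  ¬b = contradiction _ ¬b
¬T⇒𝟙≡0 {false} _  = refl

𝟙-∧ : ∀ a b → 𝟙 (a ∧ b) ≡ 𝟙 a * 𝟙 b
𝟙-∧ true  b = sym (+-identityʳ (𝟙 b))
𝟙-∧ false b = refl

𝟙*-monoʳ-≤ : ∀ b {x y} → (T b → x ≤ y) → 𝟙 b * x ≤ 𝟙 b * y
𝟙*-monoʳ-≤ true  x≤y = +-monoˡ-≤ 0 (x≤y _)
𝟙*-monoʳ-≤ false _   = z≤n

∣p∣≡∑𝟙 : ∀ {n} (p : Subset n) → ∣ p ∣ ≡ ∑[ i < n ] 𝟙 (lookup p i)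
∣p∣≡∑𝟙 []          = refl
∣p∣≡∑𝟙 (true ∷ p)  = cong suc (∣p∣≡∑𝟙 p)
∣p∣≡∑𝟙 (false ∷ p) = ∣p∣≡∑𝟙 p

∣tabulate∣≡∑𝟙 : ∀ {n} (b : Fin n → Bool) → ∣ tabulate b ∣ ≡ ∑[ i < n ] 𝟙 (b i)
∣tabulate∣≡∑𝟙 b = trans (∣p∣≡∑𝟙 (tabulate b)) (sum-cong-≗ (cong 𝟙 ∘ lookup∘tabulate b))

∑-const : ∀ k c → ∑[ i < k ] c ≡ k * c
∑-const zero    c = refl
∑-const (suc k) c = cong (c +_) (∑-const k c)

∑-mono-≤ : ∀ {k} {f g : Fin k → ℕ} → (∀ i → f i ≤ g i) → sum f ≤ sum g
∑-mono-≤ {zero}  _   = z≤n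
∑-mono-≤ {suc k} f≤g = +-mono-≤ (f≤g zero) (∑-mono-≤ (f≤g ∘ suc))

∑-mono-< : ∀ {k} {f g : Fin k → ℕ} → (∀ i → f i ≤ g i) → ∀ j → f j < g j → sum f < sum g
∑-mono-< f≤g zero    fⱼ<gⱼ = +-mono-<-≤ fⱼ<gⱼ (∑-mono-≤ (f≤g ∘ suc))
∑-mono-< f≤g (suc j) fⱼ<gⱼ = +-mono-≤-< (f≤g zero) (∑-mono-< (f≤g ∘ suc) j fⱼ<gⱼ)

∑-mono-≤-except : ∀ {k} {f g : Fin k → ℕ} j → (∀ i → i ≢ j → f i ≤ g i) → sum f ≤ sum g + f j
∑-mono-≤-except {f = f} {g} zero f≤g = begin
  f zero + sum (f ∘ suc)          ≤⟨ +-monoʳ-≤ (f zero) (∑-mono-≤ (λ i → f≤g (suc i) λ ())) ⟩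
  f zero + sum (g ∘ suc)          ≡⟨ +-comm (f zero) _ ⟩
  sum (g ∘ suc) + f zero          ≤⟨ +-monoˡ-≤ (f zero) (m≤n+m _ (g zero)) ⟩
  sum g + f zero                  ∎
  where open ≤-Reasoning
∑-mono-≤-except {f = f} {g} (suc j) f≤g = begin
  f zero + sum (f ∘ suc)                 ≤⟨ +-mono-≤ (f≤g zero λ ()) (∑-mono-≤-except j f≤g-on-tail) ⟩
  g zero + (sum (g ∘ suc) + f (suc j))   ≡⟨ +-assoc (g zero) _ _ ⟨
  sum g + f (suc j)                      ∎
  where
  open ≤-Reasoning
  f≤g-on-tail : ∀ i → i ≢ j → f (suc i) ≤ g (suc i)
  f≤g-on-tail i i≢j = f≤g (suc i) (i≢j ∘ suc-injective)

∑≤fⱼ : ∀ {k} {f : Fin k → ℕ} j → (∀ i → i ≢ j → f i ≡ 0) → sum f ≤ f j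
∑≤fⱼ {k} {f} j f≡0 = begin
  sum f                        ≤⟨ ∑-mono-≤-except j (λ i i≢j → ≤-reflexive (f≡0 i i≢j)) ⟩
  sum (replicate k 0) + f j    ≡⟨ cong (_+ f j) (sum-replicate-zero k) ⟩
  f j                          ∎
  where open ≤-Reasoning

fᵢ≤∑f : ∀ {k} (f : Fin k → ℕ) i → f i ≤ sum f
fᵢ≤∑f f zero    = m≤m+n (f zero) _
fᵢ≤∑f f (suc i) = ≤-trans (fᵢ≤∑f (f ∘ suc) i) (m≤n+m _ (f zero))

fᵢ+fⱼ≤∑f : ∀ {k} (f : Fin k → ℕ) {i j} → i ≢ j → f i + f j ≤ sum f
fᵢ+fⱼ≤∑f f {zero}  {zero}  i≢j = contradiction refl i≢j
fᵢ+fⱼ≤∑f f {zero}  {suc j} _   = +-monoʳ-≤ (f zero) (fᵢ≤∑f (f ∘ suc) j)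
fᵢ+fⱼ≤∑f f {suc i} {zero}  _   =
  subst (_≤ sum f) (+-comm (f zero) _) (+-monoʳ-≤ (f zero) (fᵢ≤∑f (f ∘ suc) i))
fᵢ+fⱼ≤∑f f {suc i} {suc j} i≢j = ≤-trans (fᵢ+fⱼ≤∑f (f ∘ suc) (i≢j ∘ cong suc)) (m≤n+m _ (f zero))

∑𝟙≡0 : ∀ {k} (b : Fin k → Bool) → (∀ i → ¬ T (b i)) → ∑[ i < k ] 𝟙 (b i) ≡ 0
∑𝟙≡0 {k} b none = trans (sum-cong-≗ (¬T⇒𝟙≡0 ∘ none)) (sum-replicate-zero k)

∑𝟙>0⇒∃T : ∀ {k} (b : Fin k → Bool) → 0 < ∑[ i < k ] 𝟙 (b i) → ∃ λ i → T (b i)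
∑𝟙>0⇒∃T b ∑>0 with any? (T? ∘ b)
... | yes found = found
... | no  none  = contradiction (∑𝟙≡0 b (λ i bᵢ → none (i , bᵢ))) (m<n⇒n≢0 ∑>0)

∑𝟙≤1 : ∀ {k} (b : Fin k → Bool) → (∀ {i j} → T (b i) → T (b j) → i ≡ j) → ∑[ i < k ] 𝟙 (b i) ≤ 1
∑𝟙≤1 b unique with any? (T? ∘ b)
... | yes (i , bᵢ) = ≤-trans (∑≤fⱼ i (λ j j≢i → ¬T⇒𝟙≡0 (λ bⱼ → j≢i (unique bⱼ bᵢ)))) (𝟙≤1 (b i))
... | no  none     = ≤-trans (≤-reflexive (∑𝟙≡0 b (λ i bᵢ → none (i , bᵢ)))) z≤n

baseWeight : ℕ → ℕ
baseWeight 0             = 2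
baseWeight 1             = 2
baseWeight (suc (suc _)) = 1

weight : ℕ → ℕ → ℕ
weight r d = if r <ᵇ d then 0 else baseWeight d

weight-low : ∀ {r d} → ¬ r < d → 1 ≤ weight r d
weight-low {r} {d} r≮d with r <ᵇ d | <ᵇ-reflects-< r d
... | true  | ofʸ r<d = contradiction r<d r≮d
... | false | _       = 1≤baseWeight d
  where
  1≤baseWeight : ∀ d → 1 ≤ baseWeight d
  1≤baseWeight 0             = s≤s z≤n
  1≤baseWeight 1             = s≤s z≤n
  1≤baseWeight (suc (suc _)) = s≤s z≤n

weight-≤1 : ∀ {r d} → 1 ≤ r → d ≤ 1 → weight r d ≡ 2
weight-≤1 {suc _} {0}           _ _        = refl
weight-≤1 {suc _} {1}           _ _        = refl
weight-≤1 {suc _} {suc (suc _)} _ (s≤s ())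

weighted-degree+slack≤r : ∀ {r} → 2 ≤ r → ∀ d → d * weight r d + r * 𝟙 (r <ᵇ d) ≤ r
weighted-degree+slack≤r {r} 2≤r d with r <ᵇ d | <ᵇ-reflects-< r d
... | true  | _        = ≤-reflexive (cong₂ _+_ (*-zeroʳ d) (*-identityʳ r))
... | false | ofⁿ r≮d = begin
  d * baseWeight d + r * 0   ≡⟨ cong (d * baseWeight d +_) (*-zeroʳ r) ⟩
  d * baseWeight d + 0       ≡⟨ +-identityʳ _ ⟩
  d * baseWeight d           ≤⟨ weighted-low-degree d (≮⇒≥ r≮d) ⟩
  r                          ∎
  where
  open ≤-Reasoning
  weighted-low-degree : ∀ d → d ≤ r → d * baseWeight d ≤ r
  weighted-low-degree 0               _   = z≤n
  weighted-low-degree 1               _   = 2≤r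
  weighted-low-degree d@(suc (suc _)) d≤r = subst (_≤ r) (sym (*-identityʳ d)) d≤r

module _ {n} (H : Hypergraph n) where

  _∋_ : Fin (m H) → Fin n → Set
  e ∋ v = T (lookup (edge H e) v)

  _∋?_ : ∀ e v → Dec (e ∋ v)
  e ∋? v = T? (lookup (edge H e) v)

  χ : Fin (m H) → Fin n → ℕ
  χ e v = 𝟙 (lookup (edge H e) v)

  χ*-monoʳ-≤ : ∀ e v {x y} → (e ∋ v → x ≤ y) → χ e v * x ≤ χ e v * y
  χ*-monoʳ-≤ e v = 𝟙*-monoʳ-≤ (lookup (edge H e) v)

  codegree : Fin n → Fin n → ℕ
  codegree u w = ∑[ e < m H ] (χ e u * χ e w)

  degree≡∑χ : ∀ v → degree H v ≡ ∑[ e < m H ] χ e v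
  degree≡∑χ v = ∣tabulate∣≡∑𝟙 (λ e → lookup (edge H e) v)

  edge-at : ∀ {v} → 0 < degree H v → ∃ λ e → e ∋ v
  edge-at {v} deg>0 = ∑𝟙>0⇒∃T (λ e → lookup (edge H e) v) (subst (0 <_) (degree≡∑χ v) deg>0)

  ∣∩∣≡∑χχ : ∀ e f → ∣ edge H e ∩ edge H f ∣ ≡ ∑[ v < n ] (χ e v * χ f v)
  ∣∩∣≡∑χχ e f = trans (∣p∣≡∑𝟙 (edge H e ∩ edge H f))
    (sum-cong-≗ λ v → trans (cong 𝟙 (lookup-zipWith _∧_ v (edge H e) (edge H f)))
                              (𝟙-∧ (lookup (edge H e) v) (lookup (edge H f) v)))

  χχ≡1 : ∀ {e f v} → e ∋ v → f ∋ v → χ e v * χ f v ≡ 1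
  χχ≡1 e∋v f∋v = cong₂ _*_ (T⇒𝟙≡1 e∋v) (T⇒𝟙≡1 f∋v)

  common-vertex⇒1≤∣∩∣ : ∀ {e f v} → e ∋ v → f ∋ v → 1 ≤ ∣ edge H e ∩ edge H f ∣
  common-vertex⇒1≤∣∩∣ {e} {f} {v} e∋v f∋v = begin
    1                             ≡⟨ χχ≡1 e∋v f∋v ⟨
    χ e v * χ f v                 ≤⟨ fᵢ≤∑f (λ w → χ e w * χ f w) v ⟩
    ∑[ w < n ] (χ e w * χ f w)      ≡⟨ ∣∩∣≡∑χχ e f ⟨
    ∣ edge H e ∩ edge H f ∣       ∎
    where open ≤-Reasoning

  handshake : (w : Fin n → ℕ) → ∑[ e < m H ] ∑[ v < n ] (χ e v * w v) ≡ ∑[ v < n ] (degree H v * w v)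
  handshake w = begin
    ∑[ e < m H ] ∑[ v < n ] (χ e v * w v)    ≡⟨ ∑-comm (λ e v → χ e v * w v) ⟩
    ∑[ v < n ] ∑[ e < m H ] (χ e v * w v)  ≡⟨ sum-cong-≗ (λ v → *-distribʳ-sum (w v) (λ e → χ e v)) ⟨
    ∑[ v < n ] ((∑[ e < m H ] χ e v) * w v)  ≡⟨ sum-cong-≗ (λ v → cong (_* w v) (degree≡∑χ v)) ⟨
    ∑[ v < n ] (degree H v * w v)            ∎
    where open ≡-Reasoning

  module _ (linear : Linear H) where

    two-common-vertices⇒≡ : ∀ {e f u w} → u ≢ w → e ∋ u → f ∋ u → e ∋ w → f ∋ w → e ≡ f
    two-common-vertices⇒≡ {e} {f} {u} {w} u≢w e∋u f∋u e∋w f∋w with e ≟ f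
    ... | yes e≡f = e≡f
    ... | no  e≢f = contradiction (linear e f e≢f) (<⇒≱ 2≤∣e∩f∣)
      where
      2≤∣e∩f∣ : 2 ≤ ∣ edge H e ∩ edge H f ∣
      2≤∣e∩f∣ = begin
        2                                 ≡⟨ cong₂ _+_ (χχ≡1 e∋u f∋u) (χχ≡1 e∋w f∋w) ⟨
        χ e u * χ f u + χ e w * χ f w     ≤⟨ fᵢ+fⱼ≤∑f (λ v → χ e v * χ f v) u≢w ⟩
        ∑[ v < n ] (χ e v * χ f v)        ≡⟨ ∣∩∣≡∑χχ e f ⟨
        ∣ edge H e ∩ edge H f ∣           ∎
        where open ≤-Reasoning

    common-vertex⇒∣∩∣≡1 : ∀ {e f v} → e ≢ f → e ∋ v → f ∋ v → ∣ edge H e ∩ edge H f ∣ ≡ 1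
    common-vertex⇒∣∩∣≡1 {e} {f} e≢f e∋v f∋v = ≤-antisym (linear e f e≢f) (common-vertex⇒1≤∣∩∣ e∋v f∋v)

    codegree≤1 : ∀ {u w} → u ≢ w → codegree u w ≤ 1
    codegree≤1 {u} {w} u≢w =
      subst (_≤ 1) (sum-cong-≗ (λ e → 𝟙-∧ (lookup (edge H e) u) (lookup (edge H e) w))) (∑𝟙≤1 _ unique)
      where
      unique : ∀ {e f} → T (lookup (edge H e) u ∧ lookup (edge H e) w) →
               T (lookup (edge H f) u ∧ lookup (edge H f) w) → e ≡ f
      unique e∋u,w f∋u,w with to T-∧ e∋u,w | to T-∧ f∋u,w
      ... | e∋u , e∋w | f∋u , f∋w = two-common-vertices⇒≡ u≢w e∋u f∋u e∋w f∋w

    -- Count pairs (f, w) with c ∈ f and w ∈ g ∩ f: each edge at c gives at least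
    -- one, and each w ∈ g lies on at most one edge with c since w ≠ c.
    degree≤∣edge∣ : ∀ {g c} → ¬ g ∋ c → (∀ {f} → f ∋ c → 1 ≤ ∣ edge H g ∩ edge H f ∣) →
                    degree H c ≤ ∣ edge H g ∣
    degree≤∣edge∣ {g} {c} g∌c meets = begin
      degree H c                                      ≡⟨ degree≡∑χ c ⟩
      ∑[ f < m H ] χ f c                              ≡⟨ sum-cong-≗ (λ f → *-identityʳ (χ f c)) ⟨
      ∑[ f < m H ] (χ f c * 1)                        ≤⟨ ∑-mono-≤ (λ f → χ*-monoʳ-≤ f c meets) ⟩
      ∑[ f < m H ] (χ f c * ∣ edge H g ∩ edge H f ∣)  ≡⟨ sum-cong-≗ (λ f → cong (χ f c *_) (∣∩∣≡∑χχ g f)) ⟩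
      ∑[ f < m H ] (χ f c * ∑[ w < n ] (χ g w * χ f w)) ≡⟨ sum-cong-≗ (λ f → *-distribˡ-sum (χ f c) (λ w → χ g w * χ f w)) ⟩
      ∑[ f < m H ] ∑[ w < n ] (χ f c * (χ g w * χ f w)) ≡⟨ ∑-comm (λ f w → χ f c * (χ g w * χ f w)) ⟩
      ∑[ w < n ] ∑[ f < m H ] (χ f c * (χ g w * χ f w)) ≡⟨ sum-cong-≗ (λ w → sum-cong-≗ (λ f → x∙yz≈y∙xz (χ f c) (χ g w) (χ f w))) ⟩
      ∑[ w < n ] ∑[ f < m H ] (χ g w * (χ f c * χ f w)) ≡⟨ sum-cong-≗ (λ w → *-distribˡ-sum (χ g w) (λ f → χ f c * χ f w)) ⟨
      ∑[ w < n ] (χ g w * codegree c w)               ≤⟨ ∑-mono-≤ (λ w → χ*-monoʳ-≤ g w (codegree≤1 ∘ c≢w)) ⟩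
      ∑[ w < n ] (χ g w * 1)                          ≡⟨ sum-cong-≗ (λ w → *-identityʳ (χ g w)) ⟩
      ∑[ w < n ] χ g w                                ≡⟨ ∣p∣≡∑𝟙 (edge H g) ⟨
      ∣ edge H g ∣                                    ∎
      where
      open ≤-Reasoning
      c≢w : ∀ {w} → g ∋ w → c ≢ w
      c≢w g∋w refl = g∌c g∋w

    module _ (P₃-free : ¬ ContainsP3 H) {r} (uniform : Uniform r H) where

      only-edge : ∀ {c e u g} → r < degree H c → e ∋ c → e ∋ u → u ≢ c → g ∋ u → g ≡ e
      only-edge {c} {e} {u} {g} r<deg e∋c e∋u u≢c g∋u with g ≟ e | g ∋? c
      ... | yes g≡e | _       = g≡e
      ... | no  _   | yes g∋c = two-common-vertices⇒≡ u≢c g∋u e∋u g∋c e∋c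
      ... | no  g≢e | no  g∌c =
        contradiction (subst (degree H c ≤_) (uniform g) (degree≤∣edge∣ g∌c meets)) (<⇒≱ r<deg)
        where
        meets : ∀ {f} → f ∋ c → 1 ≤ ∣ edge H g ∩ edge H f ∣
        meets {f} f∋c with f ≟ e
        ... | yes refl = common-vertex⇒1≤∣∩∣ g∋u e∋u
        ... | no  f≢e  = n≢0⇒n>0 λ g∩f≡0 → P₃-free (g , e , f ,
              common-vertex⇒∣∩∣≡1 g≢e g∋u e∋u , common-vertex⇒∣∩∣≡1 (f≢e ∘ sym) e∋c f∋c , g∩f≡0)

      degree≤1 : ∀ {c e u} → r < degree H c → e ∋ c → e ∋ u → u ≢ c → degree H u ≤ 1
      degree≤1 {c} {e} {u} r<deg e∋c e∋u u≢c = begin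
        degree H u            ≡⟨ degree≡∑χ u ⟩
        ∑[ g < m H ] χ g u    ≤⟨ ∑≤fⱼ e (λ g g≢e → ¬T⇒𝟙≡0 (g≢e ∘ only-edge r<deg e∋c e∋u u≢c)) ⟩
        χ e u                 ≤⟨ 𝟙≤1 _ ⟩
        1                     ∎
        where open ≤-Reasoning

      module _ (3≤r : 3 ≤ r) where

        edgeWeight : Fin (m H) → ℕ
        edgeWeight e = ∑[ v < n ] (χ e v * weight r (degree H v))

        ∑χ≡r : ∀ e → ∑[ v < n ] χ e v ≡ r
        ∑χ≡r e = trans (sym (∣p∣≡∑𝟙 (edge H e))) (uniform e)

        r<edgeWeight : ∀ {c e} → e ∋ c → r < degree H c → r < edgeWeight e
        r<edgeWeight {c} {e} e∋c r<deg = +-cancelʳ-≤ 2 (suc r) (edgeWeight e) (begin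
          suc r + 2                    ≡⟨ +-comm (suc r) 2 ⟩
          3 + r                        ≤⟨ +-monoˡ-≤ r 3≤r ⟩
          r + r                        ≡⟨ trans (*-comm r 2) (cong (r +_) (+-identityʳ r)) ⟨
          r * 2                        ≡⟨ cong (_* 2) (∑χ≡r e) ⟨
          (∑[ v < n ] χ e v) * 2       ≡⟨ *-distribʳ-sum 2 (χ e) ⟩
          ∑[ v < n ] (χ e v * 2)       ≤⟨ ∑-mono-≤-except c leaf-weight ⟩
          edgeWeight e + χ e c * 2     ≡⟨ cong (λ x → edgeWeight e + x * 2) (T⇒𝟙≡1 e∋c) ⟩
          edgeWeight e + 2             ∎)
          where
          open ≤-Reasoning
          leaf-weight : ∀ v → v ≢ c → χ e v * 2 ≤ χ e v * weight r (degree H v)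
          leaf-weight v v≢c = χ*-monoʳ-≤ e v λ e∋v →
            ≤-reflexive (sym (weight-≤1 (≤-trans (s≤s z≤n) 3≤r) (degree≤1 r<deg e∋c e∋v v≢c)))

        r≤edgeWeight : ∀ e → r ≤ edgeWeight e
        r≤edgeWeight e with any? (λ v → (e ∋? v) ×-dec (r <? degree H v))
        ... | yes (c , e∋c , r<deg) = <⇒≤ (r<edgeWeight e∋c r<deg)
        ... | no  none              = begin
          r                                        ≡⟨ ∑χ≡r e ⟨
          ∑[ v < n ] χ e v                         ≡⟨ sum-cong-≗ (λ v → *-identityʳ (χ e v)) ⟨
          ∑[ v < n ] (χ e v * 1)                   ≤⟨ ∑-mono-≤ (λ v → χ*-monoʳ-≤ e v λ e∋v →
                                                        weight-low (λ r<deg → none (v , e∋v , r<deg))) ⟩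
          edgeWeight e                             ∎
          where open ≤-Reasoning

        high : Fin n → Bool
        high v = r <ᵇ degree H v

        heavy-edge : 0 < highDegCount r H → ∃ λ e → r < edgeWeight e
        heavy-edge s>0 with ∑𝟙>0⇒∃T high (subst (0 <_) (∣tabulate∣≡∑𝟙 high) s>0)
        ... | c , c-high with <ᵇ⇒< r _ c-high
        ...   | r<deg with edge-at (≤-trans (s≤s z≤n) r<deg)
        ...     | e , e∋c = e , r<edgeWeight e∋c r<deg

        r*[m+s]<r*n : 0 < highDegCount r H → r * (m H + highDegCount r H) < r * n
        r*[m+s]<r*n s>0 with heavy-edge s>0
        ... | e , r<wₑ = begin-strict
          r * (m H + s)                                          ≡⟨ *-distribˡ-+ r (m H) s ⟩
          r * m H + r * s                                        ≡⟨ cong₂ _+_ r*m≡∑r r*s≡∑slack ⟩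
          ∑[ e < m H ] r + ∑[ v < n ] slack v                    <⟨ +-monoˡ-< _ (∑-mono-< r≤edgeWeight e r<wₑ) ⟩
          ∑[ e < m H ] edgeWeight e + ∑[ v < n ] slack v         ≡⟨ cong (_+ ∑[ v < n ] slack v) (handshake (weight r ∘ degree H)) ⟩
          ∑[ v < n ] weighted-degree v + ∑[ v < n ] slack v      ≡⟨ ∑-distrib-+ weighted-degree slack ⟨
          ∑[ v < n ] (weighted-degree v + slack v)               ≤⟨ ∑-mono-≤ (λ v → weighted-degree+slack≤r (<⇒≤ 3≤r) (degree H v)) ⟩
          ∑[ v < n ] r                                           ≡⟨ trans (∑-const n r) (*-comm n r) ⟩
          r * n                                                  ∎
          where
          open ≤-Reasoning
          s = highDegCount r H
          slack weighted-degree : Fin n → ℕ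
          slack v = r * 𝟙 (high v)
          weighted-degree v = degree H v * weight r (degree H v)
          r*m≡∑r : r * m H ≡ ∑[ e < m H ] r
          r*m≡∑r = trans (*-comm r (m H)) (sym (∑-const (m H) r))
          r*s≡∑slack : r * s ≡ ∑[ v < n ] slack v
          r*s≡∑slack = trans (cong (r *_) (∣tabulate∣≡∑𝟙 high)) (*-distribˡ-sum r (𝟙 ∘ high))

-- Linearity with r ≥ 2 already forces distinct edges.
mainTheorem5 : (r n : ℕ) → 3 ≤ r → (H : Hypergraph n) →
    DistinctEdges H → Uniform r H → Linear H → ¬ ContainsP3 H →
    0 < highDegCount r H → m H < n ∸ highDegCount r H
mainTheorem5 r n 3≤r H _ uniform linear P₃-free s>0 =
  m+n≤o⇒m≤o∸n (suc (m H)) (*-cancelˡ-< r _ _ (r*[m+s]<r*n H linear P₃-free uniform 3≤r s>0))
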